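{- Let $H$ be the graph obtained from the complete bipartite graph $\mathcal{K}_{3,3}$ by removing one edge. Then the extended permutohedron $\mathsf{R}(H)$ is not the Dedekind–MacNeille completion of the permutohedron $\mathsf{P}(H)$.
   Context: For a graph $G$, $\mathcal{C}(G)$ is the set of nonempty connected subsets of $G$. For $\boldsymbol{x}\subseteq\mathcal{C}(G)$, $\varphi(\boldsymbol{x})$ is the set of $X\in\mathcal{C}(G)$ that are the disjoint union of some nonempty finite subset of $\boldsymbol{x}$; $\check\varphi(\boldsymbol{x})=\mathcal{C}(G)\setminus\varphi(\mathcal{C}(G)\setminus\boldsymbol{x})$. $\mathsf{P}(G)$ is the poset of clopen subsets of $\mathcal{C}(G)$ ($\varphi(\boldsymbol{x})=\boldsymbol{x}=\check\varphi(\boldsymbol{x})$) and $\mathsf{R}(G)$ the complete lattice of regular closed subsets ($\boldsymbol{x}=\varphi\check\varphi(\boldsymbol{x})$), both ordered by inclusion. A complete lattice $L$ is the Dedekind–MacNeille completion of $K\subseteq L$ iff every element of $L$ is both a join and a meet of elements of $K$. -}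

module Defs where

open import Data.Nat using (ℕ)
open import Data.Bool using (Bool; true; false; T; _∧_; _∨_; not)
open import Data.Fin using (Fin; zero; suc)
open import Data.Fin.Subset using (Subset; _∈_; _∩_; _∪_; Nonempty; Empty)
                            renaming (⊥ to ∅)
open import Data.List using (List; []; _∷_; foldr)
open import Data.List.Relation.Unary.All using (All)
open import Data.List.Relation.Unary.AllPairs using (AllPairs)
open import Data.Product using (Σ; ∃; _×_; _,_)
open import Relation.Nullary using (¬_)
open import Relation.Binary.PropositionalEquality using (_≡_; _≢_)
open import Level using (Level) renaming (suc to lsuc; zero to lzero)

-- The graph H = K_{3,3} minus one edge, on vertex set Fin 6.
-- Parts A = {0,1,2}, B = {3,4,5}; the removed edge is {0,3}.

V : Set
V = Fin 6

inA : V → Bool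
inA zero = true
inA (suc zero) = true
inA (suc (suc zero)) = true
inA _ = false

isV0 : V → Bool
isV0 zero = true
isV0 _ = false

isV3 : V → Bool
isV3 (suc (suc (suc zero))) = true
isV3 _ = false

adjK33 : V → V → Bool
adjK33 u v = (inA u ∧ not (inA v)) ∨ (not (inA u) ∧ inA v)

removed : V → V → Bool
removed u v = (isV0 u ∧ isV3 v) ∨ (isV3 u ∧ isV0 v)

adjH : V → V → Bool
adjH u v = adjK33 u v ∧ not (removed u v)

Adj : V → V → Set
Adj u v = T (adjH u v)

data Reach (X : Subset 6) : V → V → Set where
  here : ∀ {u} → u ∈ X → Reach X u u
  step : ∀ {u w v} → u ∈ X → Adj u w → Reach X w v → Reach X u v

Connected : Subset 6 → Set
Connected X = Nonempty X × (∀ u v → u ∈ X → v ∈ X → Reach X u v)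

-- Collections of vertex subsets (subsets of the powerset), i.e. candidates
-- for subsets x ⊆ 𝒞(H).

Coll : Set₁
Coll = Subset 6 → Set

_⊑_ : Coll → Coll → Set
x ⊑ y = ∀ X → x X → y X

_≐_ : Coll → Coll → Set
x ≐ y = (x ⊑ y) × (y ⊑ x)

𝒞 : Coll
𝒞 = Connected

compl𝒞 : Coll → Coll
compl𝒞 x X = Connected X × ¬ x X

Disjoint : Subset 6 → Subset 6 → Set
Disjoint A B = Empty (A ∩ B)

⋃ : List (Subset 6) → Subset 6
⋃ = foldr _∪_ ∅

-- φ(x): connected X that are the disjoint union of a nonempty finite
-- subset of x (given as a nonempty list of pairwise disjoint members of x).
φ : Coll → Coll
φ x X = Connected X ×
        Σ (List (Subset 6)) λ Ys →
          (Ys ≢ []) × All x Ys × AllPairs Disjoint Ys × (⋃ Ys ≡ X)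

φ̌ : Coll → Coll
φ̌ x X = Connected X × ¬ φ (compl𝒞 x) X

In𝒞 : Coll → Set
In𝒞 x = x ⊑ 𝒞

-- elements of P(H): clopen subsets of 𝒞(H)
Clopen : Coll → Set
Clopen x = In𝒞 x × (φ x ≐ x) × (x ≐ φ̌ x)

-- elements of R(H): regular closed subsets of 𝒞(H)
RegClosed : Coll → Set
RegClosed x = In𝒞 x × (x ≐ φ (φ̌ x))

IsJoinR : (Coll → Set₁) → Coll → Set₁
IsJoinR K x = RegClosed x × (∀ y → K y → y ⊑ x) ×
              (∀ z → RegClosed z → (∀ y → K y → y ⊑ z) → x ⊑ z)

IsMeetR : (Coll → Set₁) → Coll → Set₁
IsMeetR K x = RegClosed x × (∀ y → K y → x ⊑ y) ×
              (∀ z → RegClosed z → (∀ y → K y → z ⊑ y) → z ⊑ x)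

FamP : (Coll → Set₁) → Set₁
FamP K = ∀ y → K y → Clopen y

IsDMCompletion : Set₂
IsDMCompletion =
  ∀ x → RegClosed x →
    (Σ (Coll → Set₁) λ K → FamP K × IsJoinR K x) ×
    (Σ (Coll → Set₁) λ K → FamP K × IsMeetR K x)

-- Write 0134 for the vertex set {0,1,3,4} and V for the set of all six vertices. Let
-- z = φ g for the connected sets g = 0134, 0235, 1, 134, 15, 2, 235, 24, 3, and let
-- x = φ (g ∪ {V}) = z ∪ {V}. A collection φ g is regular closed as soon as every member
-- of g lies in φ̌ (φ g), which is a finite check, so x and z belong to R(H).
-- A clopen y ⊆ x cannot contain V: V = 0234 ⊔ 15 = 0135 ⊔ 24 with 0234, 0135 ∉ x, so
-- openness of y puts 15 and 24 into y, closedness then puts 1245 = 15 ⊔ 24 into y, and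
-- openness once more puts 14 or 25 into y, although 1245 = 14 ⊔ 25 and neither is in x.
-- So every clopen below x lies below z, and z ∌ V: x is not a join of clopens in R(H).
module Submission where

open import Defs
open import Data.Bool using (_≟_)
open import Data.Bool.Properties using (T-≡)
open import Data.Empty using (⊥)
open import Data.Fin using (Fin; #_)
open import Data.Fin.Properties using (any?; all?)
open import Data.Fin.Subset
  using (Subset; outside; _∈_; _∉_; _⊆_; _⊂_; _∩_; _∪_; _─_; ⁅_⁆; ∣_∣; ⊤; Nonempty)
  renaming (⊥ to ∅)
open import Data.Fin.Subset.Properties
  using (_∈?_; _⊆?_; _⊂?_; nonempty?; anySubset?; ⊆-antisym; ∉⊥; Empty-unique; ∣p∣≤n;
         p⊂q⇒∣p∣<∣q∣; p∩q≢∅⇒∣p─q∣<∣p∣; x∈⁅x⁆; x∈⁅y⁆⇒x≡y; x∈p∪q⁺; x∈p∪q⁻; x∈p∩q⁺; x∈p∩q⁻;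
         p⊆p∪q; q⊆p∪q; p─q⊆p; x∈p∧x∉q⇒x∈p─q; ∪-identityˡ; ∪-identityʳ; ∪-zeroˡ; ∪-zeroʳ; ∪-assoc)
open import Data.List using (List; []; _∷_)
import Data.List as List
open import Data.List.Membership.Propositional using () renaming (_∈_ to _∈ˡ_)
open import Data.List.Relation.Unary.All using (All; []; _∷_)
import Data.List.Relation.Unary.All as All
open import Data.List.Relation.Unary.AllPairs using (AllPairs; []; _∷_)
open import Data.List.Relation.Unary.Any using (here; there)
open import Data.Nat using (ℕ; zero; suc; _≤_; _<_; z≤n; s≤s)
open import Data.Nat.GeneralisedArithmetic using (fold)
open import Data.Nat.Properties using (≤-trans; <-≤-trans; <⇒≱; n<1+n; ≤-pred)
open import Data.Product using (Σ; ∃; _×_; _,_; proj₁; proj₂; uncurry)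
open import Data.Sum using (_⊎_; inj₁; inj₂; [_,_])
open import Data.Vec using (tabulate; _∷_)
import Data.Vec as Vec
open import Data.Vec.Properties using (≡-dec; lookup∘tabulate; []=⇒lookup; lookup⇒[]=)
open import Data.List.Membership.DecPropositional (≡-dec {n = 6} _≟_)
  using () renaming (_∈?_ to _∈ˡ?_)
open import Function using (_∘_; id; case_of_)
open import Function.Bundles using (Equivalence)
open import Relation.Binary.PropositionalEquality using (_≡_; _≢_; refl; sym; trans; subst)
open import Relation.Nullary using (¬_; Dec; yes; no; contradiction)
open import Relation.Nullary.Decidable
  using (⌊_⌋; True; False; map′; _×-dec_; _→-dec_; ¬?; T?; toWitness; fromWitness; toWitnessFalse;
         from-yes; from-no)
open import Relation.Unary using (Decidable)

private variable
  n : ℕ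
  X R : Subset 6
  u v : V
  w w′ : Coll

⟦_⟧ : {P : Fin n → Set} → Decidable P → Subset n
⟦ P? ⟧ = tabulate (⌊_⌋ ∘ P?)

∈⟦⟧⁻ : {P : Fin n → Set} (P? : Decidable P) {x : Fin n} → x ∈ ⟦ P? ⟧ → P x
∈⟦⟧⁻ P? {x} x∈ = toWitness {a? = P? x}
  (Equivalence.from T-≡ (trans (sym (lookup∘tabulate (⌊_⌋ ∘ P?) x)) ([]=⇒lookup x∈)))

∈⟦⟧⁺ : {P : Fin n → Set} (P? : Decidable P) {x : Fin n} → P x → x ∈ ⟦ P? ⟧
∈⟦⟧⁺ P? {x} px = lookup⇒[]= x _
  (trans (lookup∘tabulate (⌊_⌋ ∘ P?) x) (Equivalence.to T-≡ (fromWitness {a? = P? x} px)))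

x∈p─q⇒x∉q : ∀ {x : Fin n} {p q : Subset n} → x ∈ p ─ q → x ∉ q
x∈p─q⇒x∉q {p = _ ∷ _} {q = outside ∷ _} Vec.here = λ ()
x∈p─q⇒x∉q {p = _ ∷ _} {q = _ ∷ _} (Vec.there x∈p─q) (Vec.there x∈q) = x∈p─q⇒x∉q x∈p─q x∈q

⊆∧¬⊂⇒⊇ : {p q : Subset n} → p ⊆ q → ¬ p ⊂ q → q ⊆ p
⊆∧¬⊂⇒⊇ {p = p} p⊆q p⊄q {x} x∈q with x ∈? p
... | yes x∈p = x∈p
... | no  x∉p = contradiction ((λ {y} → p⊆q {y}) , x , x∈q , x∉p) p⊄q

∪-─-⊆ : ∀ {A B : Subset n} → B ⊆ A → B ∪ (A ─ B) ≡ A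
∪-─-⊆ {A = A} {B} B⊆A = ⊆-antisym
  (λ x∈ → [ B⊆A , p─q⊆p A B ] (x∈p∪q⁻ B (A ─ B) x∈))
  (λ {x} x∈A → case x ∈? B of λ where
    (yes x∈B) → p⊆p∪q (A ─ B) x∈B
    (no  x∉B) → q⊆p∪q B (A ─ B) (x∈p∧x∉q⇒x∈p─q x∈A x∉B))

-- Iterating an inflationary map n + 1 times on subsets of an n-set reaches a fixed
-- point, since every step that is not yet stationary adds an element.
module Closure (f : Subset n → Subset n) (inflationary : ∀ R → R ⊆ f R) where

  private
    Closed : Subset n → Set
    Closed R = f R ⊆ R

    closed-step : ∀ {R} → Closed R → Closed (f R)
    closed-step {R} c = subst Closed (sym (⊆-antisym c (inflationary R))) c

    closed-or-grows : ∀ R k → Closed (fold R f k) ⊎ k ≤ ∣ fold R f k ∣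
    closed-or-grows R zero = inj₂ z≤n
    closed-or-grows R (suc k) with closed-or-grows R k
    ... | inj₁ c = inj₁ (closed-step c)
    ... | inj₂ k≤ with fold R f k ⊂? f (fold R f k)
    ...   | yes grows = inj₂ (≤-trans (s≤s k≤) (p⊂q⇒∣p∣<∣q∣ grows))
    ...   | no  stuck = inj₁ (closed-step (⊆∧¬⊂⇒⊇ (inflationary _) stuck))

  closure : Subset n → Subset n
  closure R = fold R f (suc n)

  closure-closed : ∀ R → f (closure R) ⊆ closure R
  closure-closed R with closed-or-grows R (suc n)
  ... | inj₁ c = c
  ... | inj₂ n<∣R∣ = contradiction (∣p∣≤n (closure R)) (<⇒≱ n<∣R∣)

  ⊆-closure : ∀ R → R ⊆ closure R
  ⊆-closure R = go (suc n)
    where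
    go : ∀ k → R ⊆ fold R f k
    go zero = id
    go (suc k) = inflationary _ ∘ go k

  closure-ind : (P : Fin n → Set) → (∀ S → (∀ {x} → x ∈ S → P x) → ∀ {x} → x ∈ f S → P x) →
                ∀ R → (∀ {x} → x ∈ R → P x) → ∀ {x} → x ∈ closure R → P x
  closure-ind P preserved R base = go (suc n)
    where
    go : ∀ k → ∀ {x} → x ∈ fold R f k → P x
    go zero = base
    go (suc k) = preserved _ (go k)

Reach-head : Reach X u v → u ∈ X
Reach-head (here u∈X) = u∈X
Reach-head (step u∈X _ _) = u∈X

Reach-snoc : ∀ {w} → Reach X u v → Adj v w → w ∈ X → Reach X u w
Reach-snoc (here u∈X) adj w∈X = step u∈X adj (here w∈X)
Reach-snoc (step u∈X adj r) adj′ w∈X = step u∈X adj (Reach-snoc r adj′ w∈X)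

Reach-closed : (∀ {a b} → a ∈ R → b ∈ X → Adj a b → b ∈ R) → Reach X u v → u ∈ R → v ∈ R
Reach-closed closed (here _) u∈R = u∈R
Reach-closed closed (step _ adj r) u∈R = Reach-closed closed r (closed u∈R (Reach-head r) adj)

adjacent-to? : ∀ R → Decidable (λ v → ∃ λ u → u ∈ R × Adj u v)
adjacent-to? R v = any? λ u → u ∈? R ×-dec T? (adjH u v)

expand : Subset 6 → Subset 6 → Subset 6
expand X R = R ∪ (X ∩ ⟦ adjacent-to? R ⟧)

∈expand⁺ : ∀ {a b} → a ∈ R → b ∈ X → Adj a b → b ∈ expand X R
∈expand⁺ {R = R} {X} {a} a∈R b∈X adj =
  x∈p∪q⁺ (inj₂ (x∈p∩q⁺ (b∈X , ∈⟦⟧⁺ (adjacent-to? R) (a , a∈R , adj))))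

∈expand⁻ : v ∈ expand X R → v ∈ R ⊎ (v ∈ X × ∃ λ a → a ∈ R × Adj a v)
∈expand⁻ {X = X} {R} v∈ with x∈p∪q⁻ R _ v∈
... | inj₁ v∈R = inj₁ v∈R
... | inj₂ v∈′ with x∈p∩q⁻ X _ v∈′
...   | v∈X , v∈nbhd = inj₂ (v∈X , ∈⟦⟧⁻ (adjacent-to? R) v∈nbhd)

-- closure X ⁅ u ⁆ is the component of u in the subgraph induced on X.
open module Component X = Closure (expand X) (λ R → p⊆p∪q _)

Reach⇒∈closure : Reach X u v → v ∈ closure X ⁅ u ⁆
Reach⇒∈closure {X = X} {u} r = Reach-closed
  (λ a∈ b∈X adj → closure-closed X ⁅ u ⁆ (∈expand⁺ a∈ b∈X adj)) r (⊆-closure X ⁅ u ⁆ (x∈⁅x⁆ u))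

∈closure⇒Reach : u ∈ X → v ∈ closure X ⁅ u ⁆ → Reach X u v
∈closure⇒Reach {u = u} {X} u∈X = closure-ind X (Reach X u) extend ⁅ u ⁆ start
  where
  start : ∀ {v} → v ∈ ⁅ u ⁆ → Reach X u v
  start v∈ rewrite x∈⁅y⁆⇒x≡y u v∈ = here u∈X
  extend : ∀ S → (∀ {x} → x ∈ S → Reach X u x) → ∀ {v} → v ∈ expand X S → Reach X u v
  extend S reach v∈ with ∈expand⁻ v∈
  ... | inj₁ v∈S = reach v∈S
  ... | inj₂ (v∈X , a , a∈S , adj) = Reach-snoc (reach a∈S) adj v∈X

connected? : Decidable Connected
connected? X = map′ sound complete (nonempty? X ×-dec all? λ u → u ∈? X →-dec X ⊆? closure X ⁅ u ⁆)
  where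
  sound : Nonempty X × (∀ u → u ∈ X → X ⊆ closure X ⁅ u ⁆) → Connected X
  sound (ne , h) = ne , λ u v u∈X v∈X → ∈closure⇒Reach u∈X (h u u∈X v∈X)
  complete : Connected X → Nonempty X × (∀ u → u ∈ X → X ⊆ closure X ⁅ u ⁆)
  complete (ne , r) = ne , λ u u∈X v∈X → Reach⇒∈closure (r u _ u∈X v∈X)

disjoint : ∀ {A B} → (∀ {x} → x ∈ A → x ∉ B) → Disjoint A B
disjoint {A} {B} h (x , x∈A∩B) = uncurry h (x∈p∩q⁻ A B x∈A∩B)

disjoint⁻ : ∀ {A B x} → Disjoint A B → x ∈ A → x ∉ B
disjoint⁻ d x∈A x∈B = d (_ , x∈p∩q⁺ (x∈A , x∈B))

Disjoint-⊆ˡ : ∀ {A B C} → C ⊆ A → Disjoint A B → Disjoint C B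
Disjoint-⊆ˡ C⊆A d = disjoint (λ x∈C x∈B → disjoint⁻ d (C⊆A x∈C) x∈B)

Disjoint-⊆ʳ : ∀ {A B C} → C ⊆ B → Disjoint A B → Disjoint A C
Disjoint-⊆ʳ C⊆B d = disjoint (λ x∈A x∈C → disjoint⁻ d x∈A (C⊆B x∈C))

Disjoint-∪ʳ : ∀ {A B C} → Disjoint A B → Disjoint A C → Disjoint A (B ∪ C)
Disjoint-∪ʳ {B = B} {C} d e =
  disjoint λ x∈A x∈B∪C → [ disjoint⁻ d x∈A , disjoint⁻ e x∈A ] (x∈p∪q⁻ B C x∈B∪C)

Disjoint-─ : ∀ A B → Disjoint B (A ─ B)
Disjoint-─ A B = disjoint λ x∈B x∈A─B → x∈p─q⇒x∉q x∈A─B x∈B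

Disjoint-⋃⁺ : ∀ {Y} Ys → All (Disjoint Y) Ys → Disjoint Y (⋃ Ys)
Disjoint-⋃⁺ [] [] = disjoint (λ _ → ∉⊥)
Disjoint-⋃⁺ (Z ∷ Zs) (d ∷ ds) = Disjoint-∪ʳ d (Disjoint-⋃⁺ Zs ds)

Disjoint-⋃⁻ : ∀ {Y} Ys → Disjoint Y (⋃ Ys) → All (Disjoint Y) Ys
Disjoint-⋃⁻ [] _ = []
Disjoint-⋃⁻ (Z ∷ Zs) d =
  Disjoint-⊆ʳ (p⊆p∪q (⋃ Zs)) d ∷ Disjoint-⋃⁻ Zs (Disjoint-⊆ʳ (q⊆p∪q Z (⋃ Zs)) d)

∪-─-cancelˡ : ∀ {A B} → Disjoint A B → (A ∪ B) ─ A ≡ B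
∪-─-cancelˡ {A} {B} d = ⊆-antisym
  (λ x∈ → [ (λ x∈A → contradiction x∈A (x∈p─q⇒x∉q x∈)) , id ] (x∈p∪q⁻ A B (p─q⊆p (A ∪ B) A x∈)))
  (λ x∈B → x∈p∧x∉q⇒x∈p─q (q⊆p∪q A B x∈B) (λ x∈A → disjoint⁻ d x∈A x∈B))

∪-─-disjoint : ∀ {A B C} → Disjoint A C → (A ∪ B) ─ C ≡ A ∪ (B ─ C)
∪-─-disjoint {A} {B} {C} d = ⊆-antisym
  (λ x∈ → [ p⊆p∪q (B ─ C) , (λ x∈B → q⊆p∪q A (B ─ C) (x∈p∧x∉q⇒x∈p─q x∈B (x∈p─q⇒x∉q x∈))) ]
            (x∈p∪q⁻ A B (p─q⊆p (A ∪ B) C x∈)))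
  (λ x∈ → [ (λ x∈A → x∈p∧x∉q⇒x∈p─q (p⊆p∪q B x∈A) (disjoint⁻ d x∈A))
          , (λ x∈B─C → x∈p∧x∉q⇒x∈p─q (q⊆p∪q A B (p─q⊆p B C x∈B─C)) (x∈p─q⇒x∉q x∈B─C)) ]
            (x∈p∪q⁻ A (B ─ C) x∈))

-- The data of φ w X other than connectivity, as an inductive family.
data Partition (w : Coll) : Subset 6 → Set where
  []    : Partition w ∅
  block : ∀ {Y U} → w Y → Disjoint Y U → Partition w U → Partition w (Y ∪ U)

Partition-map : w ⊑ w′ → Partition w X → Partition w′ X
Partition-map w⊑w′ [] = []
Partition-map w⊑w′ (block wY d p) = block (w⊑w′ _ wY) d (Partition-map w⊑w′ p)

Partition-∪ : ∀ {A B} → Partition w A → Partition w B → Disjoint A B → Partition w (A ∪ B)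
Partition-∪ {w} {B = B} [] q _ = subst (Partition w) (sym (∪-identityˡ B)) q
Partition-∪ {w} {B = B} (block {Y} {U} wY d p) q e = subst (Partition w) (sym (∪-assoc Y U B))
  (block wY (Disjoint-∪ʳ d (Disjoint-⊆ˡ (p⊆p∪q U) e)) (Partition-∪ p q (Disjoint-⊆ˡ (q⊆p∪q Y U) e)))

Partition-concat : Partition (Partition w) X → Partition w X
Partition-concat [] = []
Partition-concat (block pY d p) = Partition-∪ pY (Partition-concat p) d

Partition-[_] : w X → Partition w X
Partition-[_] {w} {X} wX = subst (Partition w) (∪-identityʳ X) (block wX (disjoint (λ _ → ∉⊥)) [])

Partition-pair : ∀ {A B} → w A → w B → Disjoint A B → Partition w (A ∪ B)
Partition-pair wA wB d = block wA d Partition-[ wB ]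

Partition-split : ∀ {i} → Partition w X → i ∈ X → ∃ λ Y → i ∈ Y × Y ⊆ X × w Y × Partition w (X ─ Y)
Partition-split [] i∈∅ = contradiction i∈∅ ∉⊥
Partition-split {w} (block {Y} {U} wY d p) i∈Y∪U with x∈p∪q⁻ Y U i∈Y∪U
... | inj₁ i∈Y = Y , i∈Y , p⊆p∪q U , wY , subst (Partition w) (sym (∪-─-cancelˡ d)) p
... | inj₂ i∈U with Partition-split p i∈U
...   | Y′ , i∈Y′ , Y′⊆U , wY′ , p′ = Y′ , i∈Y′ , q⊆p∪q Y U ∘ Y′⊆U , wY′ ,
  subst (Partition w) (sym (∪-─-disjoint (Disjoint-⊆ʳ Y′⊆U d)))
    (block wY (Disjoint-⊆ʳ (p─q⊆p U Y′) d) p′)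

Partition-drop-⊤ : ∀ {gs} → Partition (_∈ˡ (⊤ ∷ gs)) X → X ≡ ⊤ ⊎ Partition (_∈ˡ gs) X
Partition-drop-⊤ [] = inj₂ []
Partition-drop-⊤ (block (here refl) d p) = inj₁ (∪-zeroˡ _)
Partition-drop-⊤ (block {Y} (there Y∈gs) d p) with Partition-drop-⊤ p
... | inj₁ refl = inj₁ (∪-zeroʳ Y)
... | inj₂ p′ = inj₂ (block Y∈gs d p′)

-- Only the block containing a fixed element i of X is guessed, so that completeness of
-- the search is exactly Partition-split.
module _ (w? : Decidable w) where

  private
    search : ∀ k X → ∣ X ∣ < k → Dec (Partition w X)
    search (suc k) X ∣X∣<k with nonempty? X
    ... | no  X-empty = yes (subst (Partition w) (sym (Empty-unique X-empty)) [])
    ... | yes (i , i∈X) = map′ assemble (λ p → Partition-split p i∈X) (anySubset? block?)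
      where
      Block : Subset 6 → Set
      Block Y = i ∈ Y × Y ⊆ X × w Y × Partition w (X ─ Y)

      block? : ∀ Y → Dec (Block Y)
      block? Y with i ∈? Y | Y ⊆? X
      ... | no i∉Y | _ = no (i∉Y ∘ proj₁)
      ... | yes _ | no Y⊈X = no (Y⊈X ∘ proj₁ ∘ proj₂)
      ... | yes i∈Y | yes Y⊆X = map′ (λ (wY , p) → i∈Y , Y⊆X , wY , p) (λ (_ , _ , wY , p) → wY , p)
        (w? Y ×-dec search k (X ─ Y) smaller)
        where
        smaller : ∣ X ─ Y ∣ < k
        smaller = <-≤-trans (p∩q≢∅⇒∣p─q∣<∣p∣ X Y (i , x∈p∩q⁺ (i∈X , i∈Y))) (≤-pred ∣X∣<k)

      assemble : ∃ Block → Partition w X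
      assemble (Y , _ , Y⊆X , wY , p) =
        subst (Partition w) (∪-─-⊆ Y⊆X) (block wY (Disjoint-─ X Y) p)

  partition? : Decidable (Partition w)
  partition? X = search (suc ∣ X ∣) X (n<1+n ∣ X ∣)

list⇒Partition : ∀ {Ys} → All w Ys → AllPairs Disjoint Ys → Partition w (⋃ Ys)
list⇒Partition [] [] = []
list⇒Partition {Ys = _ ∷ Ys} (wY ∷ ws) (ds ∷ dss) =
  block wY (Disjoint-⋃⁺ Ys ds) (list⇒Partition ws dss)

Partition⇒list : Partition w X →
                 Σ (List (Subset 6)) λ Ys → All w Ys × AllPairs Disjoint Ys × ⋃ Ys ≡ X
Partition⇒list [] = [] , [] , [] , refl
Partition⇒list (block {Y} wY d p) with Partition⇒list p
... | Ys , ws , dss , refl = Y ∷ Ys , wY ∷ ws , Disjoint-⋃⁻ Ys d ∷ dss , refl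

φ⇒Partition : φ w X → Partition w X
φ⇒Partition (_ , _ , _ , ws , dss , refl) = list⇒Partition ws dss

Partition⇒φ : Connected X → Partition w X → φ w X
Partition⇒φ cX p with Partition⇒list p
... | Ys , ws , dss , ⋃Ys≡X = cX , Ys , Ys≢[] , ws , dss , ⋃Ys≡X
  where
  Ys≢[] : Ys ≢ []
  Ys≢[] refl = ∉⊥ (subst (proj₁ (proj₁ cX) ∈_) (sym ⋃Ys≡X) (proj₂ (proj₁ cX)))

φ? : Decidable w → Decidable (φ w)
φ? w? X = map′ (uncurry Partition⇒φ) (λ φwX → proj₁ φwX , φ⇒Partition φwX)
                (connected? X ×-dec partition? w? X)

φ̌? : Decidable w → Decidable (φ̌ w)
φ̌? w? X = connected? X ×-dec ¬? (φ? (λ Y → connected? Y ×-dec ¬? (w? Y)) X)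

φ-mono : w ⊑ w′ → φ w ⊑ φ w′
φ-mono w⊑w′ X φwX = Partition⇒φ (proj₁ φwX) (Partition-map w⊑w′ (φ⇒Partition φwX))

φ-idem : φ (φ w) ⊑ φ w
φ-idem X φφwX = Partition⇒φ (proj₁ φφwX)
  (Partition-concat (Partition-map (λ _ → φ⇒Partition) (φ⇒Partition φφwX)))

φ̌-deflationary : Decidable w → φ̌ w ⊑ w
φ̌-deflationary w? X (cX , ¬φ) with w? X
... | yes wX = wX
... | no ¬wX = contradiction (Partition⇒φ cX Partition-[ cX , ¬wX ]) ¬φ

φ-regular : Decidable w → w ⊑ φ̌ (φ w) → RegClosed (φ w)
φ-regular w? w⊑ = (λ _ → proj₁) , φ-mono w⊑ , λ X → φ-idem X ∘ φ-mono (φ̌-deflationary (φ? w?)) X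

clopen-∪-closed : ∀ {y A B} → Clopen y → y A → y B → Disjoint A B → Connected (A ∪ B) → y (A ∪ B)
clopen-∪-closed (_ , (φy⊑y , _) , _) yA yB d c = φy⊑y _ (Partition⇒φ c (Partition-pair yA yB d))

clopen-∪-open : ∀ {y A B} → Clopen y → y (A ∪ B) → Disjoint A B → Connected A → Connected B →
                ¬ y A → ¬ y B → ⊥
clopen-∪-open (_ , _ , (y⊑φ̌y , _)) yA∪B d cA cB ¬yA ¬yB with y⊑φ̌y _ yA∪B
... | c , ¬φ = ¬φ (Partition⇒φ c (Partition-pair (cA , ¬yA) (cB , ¬yB) d))

⟨_⟩ : List V → Subset 6
⟨ vs ⟩ = ⋃ (List.map ⁅_⁆ vs)

generated-by : List (Subset 6) → Coll
generated-by gs = φ (_∈ˡ gs)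

generated-by-regular : ∀ gs → All (φ̌ (generated-by gs)) gs → RegClosed (generated-by gs)
generated-by-regular gs gs-open = φ-regular (_∈ˡ? gs) (λ _ → All.lookup gs-open)

generators : List (Subset 6)
generators =
  ⟨ # 0 ∷ # 1 ∷ # 3 ∷ # 4 ∷ [] ⟩ ∷ ⟨ # 0 ∷ # 2 ∷ # 3 ∷ # 5 ∷ [] ⟩ ∷ ⟨ # 1 ∷ [] ⟩ ∷
  ⟨ # 1 ∷ # 3 ∷ # 4 ∷ [] ⟩ ∷ ⟨ # 1 ∷ # 5 ∷ [] ⟩ ∷ ⟨ # 2 ∷ [] ⟩ ∷ ⟨ # 2 ∷ # 3 ∷ # 5 ∷ [] ⟩ ∷
  ⟨ # 2 ∷ # 4 ∷ [] ⟩ ∷ ⟨ # 3 ∷ [] ⟩ ∷ []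

x z : Coll
x = generated-by (⊤ ∷ generators)
z = generated-by generators

x-regular : RegClosed x
x-regular = generated-by-regular _
  (from-yes (All.all? (φ̌? (φ? (_∈ˡ? (⊤ ∷ generators)))) (⊤ ∷ generators)))

z-regular : RegClosed z
z-regular = generated-by-regular _ (from-yes (All.all? (φ̌? (φ? (_∈ˡ? generators))) generators))

⊤∈x : x ⊤
⊤∈x = Partition⇒φ (from-yes (connected? ⊤)) Partition-[ here refl ]

⊤∉z : ¬ z ⊤
⊤∉z = from-no (φ? (_∈ˡ? generators) ⊤)

decide-connected : ∀ X {_ : True (connected? X)} → Connected X
decide-connected X {c} = toWitness c

decide-disjoint : ∀ A B {_ : False (nonempty? (A ∩ B))} → Disjoint A B
decide-disjoint A B {d} = toWitnessFalse d

decide-∉x : ∀ X {_ : False (φ? (_∈ˡ? (⊤ ∷ generators)) X)} → ¬ x X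
decide-∉x X {d} = toWitnessFalse d

⊤∉clopen-below-x : ∀ {y} → Clopen y → y ⊑ x → ¬ y ⊤
⊤∉clopen-below-x {y} c y⊑x y⊤ =
  ¬¬y₁₅ λ y₁₅ → ¬¬y₂₄ λ y₂₄ →
    clopen-∪-open {A = s₁₄} {B = s₂₅} c
      (clopen-∪-closed c y₁₅ y₂₄ (decide-disjoint s₁₅ s₂₄) (decide-connected (s₁₅ ∪ s₂₄)))
      (decide-disjoint s₁₄ s₂₅) (decide-connected s₁₄) (decide-connected s₂₅)
      (∉y (decide-∉x s₁₄)) (∉y (decide-∉x s₂₅))
  where
  s₁₄ s₁₅ s₂₄ s₂₅ s₀₂₃₄ s₀₁₃₅ : Subset 6
  s₁₄ = ⟨ # 1 ∷ # 4 ∷ [] ⟩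
  s₁₅ = ⟨ # 1 ∷ # 5 ∷ [] ⟩
  s₂₄ = ⟨ # 2 ∷ # 4 ∷ [] ⟩
  s₂₅ = ⟨ # 2 ∷ # 5 ∷ [] ⟩
  s₀₂₃₄ = ⟨ # 0 ∷ # 2 ∷ # 3 ∷ # 4 ∷ [] ⟩
  s₀₁₃₅ = ⟨ # 0 ∷ # 1 ∷ # 3 ∷ # 5 ∷ [] ⟩
  ∉y : ∀ {A} → ¬ x A → ¬ y A
  ∉y ¬xA = ¬xA ∘ y⊑x _
  ¬¬y₁₅ : ¬ ¬ y s₁₅
  ¬¬y₁₅ = clopen-∪-open {A = s₀₂₃₄} {B = s₁₅} c y⊤ (decide-disjoint s₀₂₃₄ s₁₅)
            (decide-connected s₀₂₃₄) (decide-connected s₁₅) (∉y (decide-∉x s₀₂₃₄))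
  ¬¬y₂₄ : ¬ ¬ y s₂₄
  ¬¬y₂₄ = clopen-∪-open {A = s₀₁₃₅} {B = s₂₄} c y⊤ (decide-disjoint s₀₁₃₅ s₂₄)
            (decide-connected s₀₁₃₅) (decide-connected s₂₄) (∉y (decide-∉x s₀₁₃₅))

clopen-below-x⇒below-z : ∀ {y} → Clopen y → y ⊑ x → y ⊑ z
clopen-below-x⇒below-z c y⊑x X yX with Partition-drop-⊤ (φ⇒Partition (y⊑x X yX))
... | inj₁ refl = contradiction yX (⊤∉clopen-below-x c y⊑x)
... | inj₂ p = Partition⇒φ (proj₁ (y⊑x X yX)) p

x-not-a-join-of-clopens : ¬ Σ (Coll → Set₁) λ K → FamP K × IsJoinR K x
x-not-a-join-of-clopens (K , K⊆P , _ , below-x , least-above) =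
  ⊤∉z (least-above z z-regular below-z ⊤ ⊤∈x)
  where
  below-z : ∀ y → K y → y ⊑ z
  below-z y Ky = clopen-below-x⇒below-z (K⊆P y Ky) (below-x y Ky)

corollary17p2 : ¬ IsDMCompletion
corollary17p2 dm = x-not-a-join-of-clopens (proj₁ (dm x x-regular))
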